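{- Let $h_1\ge\dots\ge h_n>0$ be integers and $m,k\ge1$ integers. If there exist an $m\mathrm{RP}(h_1\dots h_n)$ and a $k\mathrm{RP}(h_1\dots h_n)$, then there exists an $(m+k-1)\mathrm{RP}(h_1\dots h_n)$.
   Context: Let $N=\sum h_i$. An $m$-dimensional latin hypercube of order $N$ is a function $L:[N]^m\to[N]$ such that whenever two index tuples differ in exactly one coordinate their values differ. A subhypercube of order $h$ is the restriction of $L$ to $T_1\times\dots\times T_m$ with $|T_j|=h$ for all $j$ which is itself a latin hypercube of order $h$ (on $h$ symbols); subhypercubes are disjoint if their index sets are disjoint in every coordinate and their symbol sets are disjoint. An $m\mathrm{RP}(h_1\dots h_n)$ ($m$-realization) is an $m$-dimensional latin hypercube of order $N$ with pairwise disjoint subhypercubes of orders $h_1,\dots,h_n$. -}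

module Defs where

open import Data.Nat using (ℕ; _≥_; _>_)
open import Data.Fin using (Fin)
open import Data.Fin.Subset using (Subset; _∈_; ∣_∣; Empty; _∩_)
open import Data.Vec using (Vec; lookup; sum)
open import Data.Product using (Σ; _×_)
open import Relation.Binary.PropositionalEquality using (_≡_; _≢_)
open import Level using (0ℓ)

Tuple : ℕ → ℕ → Set
Tuple m N = Fin m → Fin N

DifferInExactlyOne : ∀ {m N} → Tuple m N → Tuple m N → Set
DifferInExactlyOne {m} x y =
  Σ (Fin m) λ j → (x j ≢ y j) × (∀ i → i ≢ j → x i ≡ y i)

IsLatinHypercube : ∀ {m N} → (Tuple m N → Fin N) → Set
IsLatinHypercube {m} {N} L =
  ∀ (x y : Tuple m N) → DifferInExactlyOne x y → L x ≢ L y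

Disjoint : ∀ {N} → Subset N → Subset N → Set
Disjoint A B = Empty (A ∩ B)

-- An m-realization mRP(h_1 … h_n): a latin hypercube of order N = Σ h_i
-- with pairwise disjoint subhypercubes of orders h_1, …, h_n.
-- Subhypercube i: index sets T i j (one per coordinate j), each of size h_i,
-- and symbol set S i of size h_i, such that L maps T i 1 × … × T i m into S i
-- (so the restriction is a latin hypercube of order h_i on the h_i symbols S i).
record Realization (m : ℕ) {n : ℕ} (h : Vec ℕ n) : Set where
  field
    L       : Tuple m (sum h) → Fin (sum h)
    latin   : IsLatinHypercube L
    T       : Fin n → Fin m → Subset (sum h)
    S       : Fin n → Subset (sum h)
    T-size  : ∀ i j → ∣ T i j ∣ ≡ lookup h i
    S-size  : ∀ i → ∣ S i ∣ ≡ lookup h i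
    sub     : ∀ i (x : Tuple m (sum h)) → (∀ j → x j ∈ T i j) → L x ∈ S i
    T-disj  : ∀ i i' → i ≢ i' → ∀ j → Disjoint (T i j) (T i' j)
    S-disj  : ∀ i i' → i ≢ i' → Disjoint (S i) (S i')

-- Substitute the first hypercube into one coordinate of the second: for u ∈ [N]^m and v ∈ [N]^(k-1)
-- put L(u, v) = L₂(σ(L₁ u), v), where σ is a permutation of the symbols sending each symbol set S¹ᵢ
-- of the first realization onto the first index set T²ᵢ₁ of the second. Changing one coordinate of u
-- changes L₁ u, hence σ(L₁ u), hence L; changing one coordinate of v changes L₂. The i-th subhypercube
-- is T¹ᵢ₁ × … × T¹ᵢₘ × T²ᵢ₂ × … × T²ᵢₖ with symbols S²ᵢ. Such a σ exists because both families consist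
-- of pairwise disjoint sets with |S¹ᵢ| = hᵢ = |T²ᵢ₁|: colour each point by the set containing it
-- (one extra colour for the rest); two colourings of [N] with equal colour class sizes differ by a
-- permutation.
module Submission where

open import Defs
open import Data.Nat using (ℕ; _≥_; _>_; _+_; _∸_)
open import Data.Fin using (Fin; _≤_)
open import Data.Vec using (Vec; lookup)

open import Data.Bool using (if_then_else_)
open import Data.Fin using (zero; suc; punchIn; _≟_; _↑ˡ_; _↑ʳ_; splitAt)
open import Data.Fin.Permutation using (Permutation; _⟨$⟩ʳ_; id; insert; insert-punchIn)
open import Data.Fin.Properties
  using (any?; punchInᵢ≢i; ↑ˡ-injective; ↑ʳ-injective; join-splitAt; splitAt-↑ˡ; splitAt-↑ʳ)
open import Data.Fin.Subset using (Subset; _∈_; ∣_∣; inside; outside)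
open import Data.Fin.Subset.Properties using (_∈?_; x∈p∩q⁺; drop-there)
open import Data.Nat using (zero; suc)
open import Data.Nat.Properties using (+-0-commutativeMonoid; +-cancelˡ-≡; +-cancelʳ-≡; +-suc; 1+n≢0)
open import Data.Product using (Σ; _×_; _,_; proj₁; proj₂)
open import Data.Sum using (_⊎_; inj₁; inj₂)
open import Data.Vec using ([]; _∷_; here; there; tabulate)
open import Data.Vec.Properties using (lookup∘tabulate; tabulate-cong)
import Data.Vec.Functional as Vector
open import Data.Vec.Functional.Properties using (lookup-++ˡ; lookup-++ʳ)
import Data.Vec.Functional.Relation.Binary.Pointwise.Properties as Pointwise
import Data.Vec.Functional.Relation.Unary.All.Properties as All
open import Function using (_∘_; case_of_; Injective; Injection)
open import Function.Properties.Inverse using (↔⇒↣)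
open import Relation.Binary.PropositionalEquality
open import Relation.Nullary using (does; yes; no; contradiction)
open import Relation.Nullary.Decidable using (dec-true; dec-false)
open import Algebra.Properties.CommutativeMonoid.Sum +-0-commutativeMonoid
  using (sum; sum-remove; ∑-distrib-+; sum-cong-≗; sum-replicate-zero)

δ : ∀ {K} → Fin K → Fin K → ℕ
δ a c = if does (a ≟ c) then 1 else 0

δ-refl : ∀ {K} (a : Fin K) → δ a a ≡ 1
δ-refl a rewrite dec-true (a ≟ a) refl = refl

δ-≢ : ∀ {K} {a c : Fin K} → a ≢ c → δ a c ≡ 0
δ-≢ {a = a} {c} a≢c rewrite dec-false (a ≟ c) a≢c = refl

∑-δ : ∀ {K} (a : Fin K) → sum (δ a) ≡ 1
∑-δ {suc K} a = begin
  sum (δ a)                      ≡⟨ sum-remove {i = a} (δ a) ⟩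
  δ a a + sum (δ a ∘ punchIn a)  ≡⟨ cong₂ _+_ (δ-refl a) (sum-cong-≗ (λ c → δ-≢ (punchInᵢ≢i a c ∘ sym))) ⟩
  1 + sum {K} (λ _ → 0)          ≡⟨ cong (1 +_) (sum-replicate-zero K) ⟩
  1                              ∎
  where open ≡-Reasoning

count : ∀ {N K} → (Fin N → Fin K) → Fin K → ℕ
count {N} f c = sum {N} (λ x → δ (f x) c)

∑-count : ∀ {N K} (f : Fin N → Fin K) → sum (count f) ≡ N
∑-count {zero} {K} f = sum-replicate-zero K
∑-count {suc N} f = begin
  sum (λ c → δ (f zero) c + count (f ∘ suc) c)  ≡⟨ ∑-distrib-+ (δ (f zero)) (count (f ∘ suc)) ⟩
  sum (δ (f zero)) + sum (count (f ∘ suc))      ≡⟨ cong₂ _+_ (∑-δ (f zero)) (∑-count (f ∘ suc)) ⟩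
  suc N                                         ∎
  where open ≡-Reasoning

count-punchIn : ∀ {N K} (f : Fin (suc N) → Fin K) y c →
  count f c ≡ δ (f y) c + count (f ∘ punchIn y) c
count-punchIn f y c = sum-remove {i = y} (λ x → δ (f x) c)

count-∋ : ∀ {N K} (f : Fin (suc N) → Fin K) x → count f (f x) ≡ suc (count (f ∘ punchIn x) (f x))
count-∋ f x = trans (count-punchIn f x (f x)) (cong (_+ count (f ∘ punchIn x) (f x)) (δ-refl (f x)))

count-∉ : ∀ {N K} (f : Fin N → Fin K) c → (∀ x → f x ≢ c) → count f c ≡ 0
count-∉ {N} f c f≢c = trans (sum-cong-≗ (δ-≢ ∘ f≢c)) (sum-replicate-zero N)

count-fibre : ∀ {N K} (f : Fin N → Fin K) c (p : Subset N) →
  (∀ x → f x ≡ c → x ∈ p) → (∀ x → x ∈ p → f x ≡ c) → count f c ≡ ∣ p ∣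
count-fibre {zero} f c [] _ _ = refl
count-fibre {suc N} f c (b ∷ p) fibre⊆b∷p b∷p⊆fibre = begin
  δ (f zero) c + count (f ∘ suc) c  ≡⟨ cong (δ (f zero) c +_) (count-fibre (f ∘ suc) c p
                                         (λ x → drop-there ∘ fibre⊆b∷p (suc x)) (λ x → b∷p⊆fibre (suc x) ∘ there)) ⟩
  δ (f zero) c + ∣ p ∣              ≡⟨ δ-head b fibre⊆b∷p b∷p⊆fibre ⟩
  ∣ b ∷ p ∣                         ∎
  where
  open ≡-Reasoning
  δ-head : ∀ b → (∀ x → f x ≡ c → x ∈ b ∷ p) → (∀ x → x ∈ b ∷ p → f x ≡ c) → δ (f zero) c + ∣ p ∣ ≡ ∣ b ∷ p ∣
  δ-head inside _ b∷p⊆fibre = cong (_+ ∣ p ∣) (trans (cong (λ a → δ a c) (b∷p⊆fibre zero here)) (δ-refl c))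
  δ-head outside fibre⊆b∷p _ = cong (_+ ∣ p ∣) (δ-≢ (λ f₀≡c → case fibre⊆b∷p zero f₀≡c of λ ()))

colouring-permutation : ∀ {N K} (f g : Fin N → Fin K) → (∀ c → count f c ≡ count g c) →
  Σ (Permutation N N) λ π → ∀ x → g (π ⟨$⟩ʳ x) ≡ f x
colouring-permutation {zero} f g _ = id , λ ()
colouring-permutation {suc N} f g counts with any? (λ y → g y ≟ f zero)
... | no g∌f₀ = contradiction (trans (counts (f zero)) (count-∉ g (f zero) (λ x gx≡f₀ → g∌f₀ (x , gx≡f₀))))
                              (λ count≡0 → 1+n≢0 (trans (sym (count-∋ f zero)) count≡0))
... | yes (y , gy≡f₀) = insert zero y π ,
      λ { zero → gy≡f₀ ; (suc x) → trans (cong g (insert-punchIn zero y π x)) (π-colours x) }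
  where
  counts′ : ∀ c → count (f ∘ suc) c ≡ count (g ∘ punchIn y) c
  counts′ c = +-cancelˡ-≡ (δ (f zero) c) _ _ (begin
    count f c                            ≡⟨ counts c ⟩
    count g c                            ≡⟨ count-punchIn g y c ⟩
    δ (g y) c + count (g ∘ punchIn y) c  ≡⟨ cong (λ a → δ a c + count (g ∘ punchIn y) c) gy≡f₀ ⟩
    δ (f zero) c + count (g ∘ punchIn y) c ∎)
    where open ≡-Reasoning
  matching = colouring-permutation (f ∘ suc) (g ∘ punchIn y) counts′
  π = proj₁ matching
  π-colours = proj₂ matching

PairwiseDisjoint : ∀ {n N} → (Fin n → Subset N) → Set
PairwiseDisjoint A = ∀ i i′ → i ≢ i′ → Disjoint (A i) (A i′)

∈-unique : ∀ {n N} {A : Fin n → Subset N} → PairwiseDisjoint A →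
  ∀ {x i j} → x ∈ A i → x ∈ A j → i ≡ j
∈-unique disjoint {i = i} {j} x∈Aᵢ x∈Aⱼ with i ≟ j
... | yes i≡j = i≡j
... | no i≢j = contradiction (_ , x∈p∩q⁺ (x∈Aᵢ , x∈Aⱼ)) (disjoint i j i≢j)

colour : ∀ {n N} → (Fin n → Subset N) → Fin N → Fin (suc n)
colour A x with any? (λ i → x ∈? A i)
... | yes (i , _) = suc i
... | no _ = zero

colour≡suc⇒∈ : ∀ {n N} (A : Fin n → Subset N) {x i} → colour A x ≡ suc i → x ∈ A i
colour≡suc⇒∈ A {x} colour≡suc with any? (λ i → x ∈? A i)
colour≡suc⇒∈ A refl | yes (_ , x∈Aᵢ) = x∈Aᵢ

∈⇒colour≡suc : ∀ {n N} {A : Fin n → Subset N} → PairwiseDisjoint A →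
  ∀ {x i} → x ∈ A i → colour A x ≡ suc i
∈⇒colour≡suc {A = A} disjoint {x} x∈Aᵢ with any? (λ i → x ∈? A i)
... | yes (_ , x∈Aⱼ) = cong suc (∈-unique disjoint x∈Aⱼ x∈Aᵢ)
... | no x∉⋃A = contradiction (_ , x∈Aᵢ) x∉⋃A

disjoint-families-permutation : ∀ {n N} (A B : Fin n → Subset N) →
  PairwiseDisjoint A → PairwiseDisjoint B → (∀ i → ∣ A i ∣ ≡ ∣ B i ∣) →
  Σ (Permutation N N) λ π → ∀ {i x} → x ∈ A i → π ⟨$⟩ʳ x ∈ B i
disjoint-families-permutation {n} {N} A B A-disjoint B-disjoint sizes =
  π , λ x∈Aᵢ → colour≡suc⇒∈ B (trans (π-colours _) (∈⇒colour≡suc A-disjoint x∈Aᵢ))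
  where
  open ≡-Reasoning
  count-colour : ∀ {C : Fin n → Subset N} → PairwiseDisjoint C → ∀ i → count (colour C) (suc i) ≡ ∣ C i ∣
  count-colour {C} C-disjoint i =
    count-fibre (colour C) (suc i) (C i) (λ _ → colour≡suc⇒∈ C) (λ _ → ∈⇒colour≡suc C-disjoint)
  coloured : ∀ i → count (colour A) (suc i) ≡ count (colour B) (suc i)
  coloured i = trans (count-colour A-disjoint i) (trans (sizes i) (sym (count-colour B-disjoint i)))
  uncoloured : count (colour A) zero ≡ count (colour B) zero
  uncoloured = +-cancelʳ-≡ _ _ _ (begin
    count (colour A) zero + sum (count (colour A) ∘ suc)  ≡⟨ ∑-count (colour A) ⟩
    N                                                    ≡⟨ ∑-count (colour B) ⟨
    count (colour B) zero + sum (count (colour B) ∘ suc)  ≡⟨ cong (_ +_) (sum-cong-≗ coloured) ⟨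
    count (colour B) zero + sum (count (colour A) ∘ suc)  ∎)
  colours-agree : ∀ c → count (colour A) c ≡ count (colour B) c
  colours-agree zero = uncoloured
  colours-agree (suc i) = coloured i
  matching = colouring-permutation (colour A) (colour B) colours-agree
  π = proj₁ matching
  π-colours = proj₂ matching

differ-≗ : ∀ {m N} {x x′ y y′ : Tuple m N} → x ≗ x′ → y ≗ y′ →
  DifferInExactlyOne x y → DifferInExactlyOne x′ y′
differ-≗ x≗x′ y≗y′ (j , xⱼ≢yⱼ , x≈y) =
  j , (λ e → xⱼ≢yⱼ (trans (x≗x′ j) (trans e (sym (y≗y′ j))))) ,
  λ i i≢j → trans (sym (x≗x′ i)) (trans (x≈y i i≢j) (y≗y′ i))

differ-head : ∀ {m N} {a b : Fin N} {x y : Tuple m N} → a ≢ b → x ≗ y →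
  DifferInExactlyOne (a Vector.∷ x) (b Vector.∷ y)
differ-head a≢b x≗y = zero , a≢b , λ { zero 0≢0 → contradiction refl 0≢0 ; (suc i) _ → x≗y i }

differ-tail : ∀ {m N} {a b : Fin N} {x y : Tuple m N} → a ≡ b → DifferInExactlyOne x y →
  DifferInExactlyOne (a Vector.∷ x) (b Vector.∷ y)
differ-tail a≡b (j , xⱼ≢yⱼ , x≈y) =
  suc j , xⱼ≢yⱼ , λ { zero _ → a≡b ; (suc i) i≢j → x≈y i (i≢j ∘ cong suc) }

↑ˡ≢↑ʳ : ∀ {p q} (i : Fin p) (j : Fin q) → i ↑ˡ q ≢ p ↑ʳ j
↑ˡ≢↑ʳ {p} {q} i j e with () ← trans (sym (splitAt-↑ˡ p i q)) (trans (cong (splitAt p) e) (splitAt-↑ʳ p q j))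

differ-split : ∀ {p q N} {x y : Tuple (p + q) N} → DifferInExactlyOne x y →
  DifferInExactlyOne (Vector.take p x) (Vector.take p y) × Vector.drop p x ≗ Vector.drop p y ⊎
  Vector.take p x ≗ Vector.take p y × DifferInExactlyOne (Vector.drop p x) (Vector.drop p y)
differ-split {p} {q} (c , x≢y , x≈y) with splitAt p c | join-splitAt p q c
... | inj₁ i | refl = inj₁ ((i , x≢y , λ i′ i′≢i → x≈y (i′ ↑ˡ q) (i′≢i ∘ ↑ˡ-injective q i′ i)) ,
                            λ j → x≈y (p ↑ʳ j) (↑ˡ≢↑ʳ i j ∘ sym))
... | inj₂ j | refl = inj₂ ((λ i → x≈y (i ↑ˡ q) (↑ˡ≢↑ʳ i j)) ,
                            (j , x≢y , λ j′ j′≢j → x≈y (p ↑ʳ j′) (j′≢j ∘ ↑ʳ-injective p j′ j)))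

-- Going through the table of take p x makes the value depend only on the entries of x, which the
-- second case of substitute-latin needs in the absence of function extensionality.
substitute : ∀ {p q N} → (Tuple p N → Fin N) → (Fin N → Fin N) → (Tuple (suc q) N → Fin N) →
  Tuple (p + q) N → Fin N
substitute {p} L₁ σ L₂ x = L₂ (σ (L₁ (lookup (tabulate (Vector.take p x)))) Vector.∷ Vector.drop p x)

substitute-latin : ∀ {p q N} {L₁ : Tuple p N → Fin N} {σ : Fin N → Fin N} {L₂ : Tuple (suc q) N → Fin N} →
  IsLatinHypercube L₁ → Injective _≡_ _≡_ σ → IsLatinHypercube L₂ → IsLatinHypercube (substitute L₁ σ L₂)
substitute-latin {p} {q} {L₁ = L₁} {σ} L₁-latin σ-injective L₂-latin x y x~y with differ-split {p} {q} x~y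
... | inj₁ (front-differ , back≗) = L₂-latin _ _ (differ-head
      (L₁-latin _ _ (differ-≗ (sym ∘ lookup∘tabulate _) (sym ∘ lookup∘tabulate _) front-differ) ∘ σ-injective)
      back≗)
... | inj₂ (front≗ , back-differ) = L₂-latin _ _
      (differ-tail (cong (σ ∘ L₁ ∘ lookup) (tabulate-cong front≗)) back-differ)

substitute-realization : ∀ {p q n} {h : Vec ℕ n} → Realization p h → Realization (suc q) h → Realization (p + q) h
substitute-realization {p} {q} {h = h} R₁ R₂ = record
  { L = substitute R₁.L σ R₂.L
  ; latin = substitute-latin R₁.latin (Injection.injective (↔⇒↣ π)) R₂.latin
  ; T = T
  ; S = R₂.S
  ; T-size = λ i → All.++⁺ (λ t → ∣ t ∣ ≡ lookup h i) (R₁.T-size i) (R₂.T-size i ∘ suc)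
  ; S-size = R₂.S-size
  ; sub = sub
  ; T-disj = λ i i′ i≢i′ → Pointwise.++⁺ Disjoint (R₁.T-disj i i′ i≢i′) (R₂.T-disj i i′ i≢i′ ∘ suc)
  ; S-disj = R₂.S-disj
  }
  where
  module R₁ = Realization R₁
  module R₂ = Realization R₂
  matching = disjoint-families-permutation R₁.S (λ i → R₂.T i zero) R₁.S-disj
    (λ i i′ i≢i′ → R₂.T-disj i i′ i≢i′ zero) (λ i → trans (R₁.S-size i) (sym (R₂.T-size i zero)))
  π = proj₁ matching
  σ = π ⟨$⟩ʳ_
  T : Fin _ → Fin (p + q) → Subset _
  T i = R₁.T i Vector.++ Vector.tail (R₂.T i)
  sub : ∀ i x → (∀ c → x c ∈ T i c) → substitute R₁.L σ R₂.L x ∈ R₂.S i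
  sub i x x∈T = R₂.sub i _ λ
    { zero → proj₂ matching (R₁.sub i _ λ j →
        subst₂ _∈_ (sym (lookup∘tabulate _ j)) (lookup-++ˡ (R₁.T i) _ j) (x∈T (j ↑ˡ q)))
    ; (suc j) → subst (x (p ↑ʳ j) ∈_) (lookup-++ʳ (R₁.T i) (Vector.tail (R₂.T i)) j) (x∈T (p ↑ʳ j))
    }

theorem20 : ∀ {n} (h : Vec ℕ n) (m k : ℕ) →
    (∀ (i j : Fin n) → i ≤ j → lookup h i ≥ lookup h j) →
    (∀ (i : Fin n) → lookup h i > 0) →
    m ≥ 1 → k ≥ 1 →
    Realization m h → Realization k h → Realization (m + k ∸ 1) h
theorem20 h (suc m) (suc k) _ _ _ _ R₁ R₂ =
  subst (λ d → Realization d h) (sym (+-suc m k)) (substitute-realization R₁ R₂)
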